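{- Every semicomplete multipartite digraph $D$ with partite sets $V_1,\ldots,V_c$ contains a good G-path of length exactly $c-1$.
   Context: All digraphs are finite, without loops or parallel arcs (2-cycles allowed). A digraph $D$ is a semicomplete multipartite digraph if $V(D)$ has a partition into nonempty sets $V_1,\ldots,V_c$ (partite sets) such that no arc has both ends in the same $V_i$ and any two vertices in different partite sets are joined by at least one arc. A G-path of $D$ is a sequence of $r\ge1$ pairwise vertex-disjoint directed paths $P_1,\ldots,P_r$ of $D$ (a path may be a single vertex), $P_i$ from $u_i$ to $v_i$, such that $v_i$ and $u_{i+1}$ lie in the same partite set for every $i\in[r-1]$. Its length is the total number of arcs of the paths $P_i$. It is good if it contains at least one vertex from each partite set. -}

module Defs where

open import Data.Nat using (ℕ; suc; _∸_)
open import Data.Fin using (Fin)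
open import Data.List using (List; concat)
open import Data.Nat.ListAction using (sum)
open import Data.List.NonEmpty using (List⁺; toList; head; last; tail)
import Data.List
open import Data.List.Relation.Unary.All using (All)
open import Data.List.Relation.Unary.Linked using (Linked)
open import Data.List.Relation.Unary.Unique.Propositional using (Unique)
open import Data.List.Membership.Propositional using (_∈_)
open import Data.Product using (Σ; _×_; ∃-syntax)
open import Data.Sum using (_⊎_)
open import Relation.Binary.PropositionalEquality using (_≡_; _≢_)
open import Relation.Nullary using (¬_)
open import Level using (0ℓ; suc)

-- Loops and parallel arcs
-- are excluded automatically (a relation has at most one arc u→v; loops are
-- ruled out below since u, u lie in the same partite set).
-- A semicomplete multipartite digraph with c partite sets V_0..V_{c-1}:
-- `part v` is the index of the partite set containing v.
record SMD (n c : ℕ) : Set₁ where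
  field
    Arc       : Fin n → Fin n → Set
    part      : Fin n → Fin c
    part-surj : ∀ (j : Fin c) → ∃[ v ] part v ≡ j
    arc-cross : ∀ {u v} → Arc u v → part u ≢ part v
    semicomplete : ∀ u v → part u ≢ part v → Arc u v ⊎ Arc v u

module _ {n c : ℕ} (D : SMD n c) where
  open SMD D

  -- A directed path: nonempty vertex sequence with consecutive arcs
  -- (vertex-distinctness is imposed globally in GPath).
  IsPath : List⁺ (Fin n) → Set
  IsPath P = Linked Arc (toList P)

  vertices : List⁺ (List⁺ (Fin n)) → List (Fin n)
  vertices Ps = concat (Data.List.map toList (toList Ps))

  record IsGPath (Ps : List⁺ (List⁺ (Fin n))) : Set where
    field
      paths    : All IsPath (toList Ps)
      disjoint : Unique (vertices Ps)
      linked   : Linked (λ P Q → part (last P) ≡ part (head Q)) (toList Ps)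

  -- number of arcs of a path = number of vertices minus one
  gLength : List⁺ (List⁺ (Fin n)) → ℕ
  gLength Ps = sum (Data.List.map (λ P → Data.List.length (tail P)) (toList Ps))

  IsGood : List⁺ (List⁺ (Fin n)) → Set
  IsGood Ps = ∀ (j : Fin c) → ∃[ v ] (v ∈ vertices Ps × part v ≡ j)

{-# OPTIONS --safe #-}
-- Choose one vertex from each partite set.  Vertices of distinct partite sets
-- are joined by an arc, so these c representatives span a semicomplete
-- digraph, which by Rédei's theorem has a Hamiltonian path.  That single path
-- is a G-path (with r = 1) meeting every partite set, and it has c − 1 arcs.
module Submission where

open import Defs
open import Data.Nat using (ℕ; _∸_; _≥_; s≤s)
open import Data.Nat.Properties using (+-identityʳ)
open import Data.Fin using (Fin)
open import Data.List using (List; []; _∷_; map; length; allFin)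
open import Data.List.NonEmpty using (List⁺; _∷_; toList; tail)
open import Data.List.Properties using (++-identityʳ; length-map; length-tabulate)
open import Data.List.Relation.Unary.All using (All; []; _∷_)
open import Data.List.Relation.Unary.AllPairs as AllPairs using (AllPairs; []; _∷_)
import Data.List.Relation.Unary.AllPairs.Properties as AllPairsₚ
open import Data.List.Relation.Unary.Linked as Linked using (Linked; []; [-]; _∷_)
open import Data.List.Relation.Unary.Unique.Propositional using (Unique)
import Data.List.Relation.Unary.Unique.Propositional.Properties as Uniqueₚ
open import Data.List.Membership.Propositional using (_∈_)
open import Data.List.Membership.Propositional.Properties using (∈-allFin; ∈-map⁺)
open import Data.List.Relation.Binary.Permutation.Propositional
  using (_↭_; ↭-refl; ↭-prep; ↭-swap; ↭-trans; ↭-sym; ↭⇒↭ₛ)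
open import Data.List.Relation.Binary.Permutation.Propositional.Properties
  using (All-resp-↭; ∈-resp-↭; ↭-length; ¬x∷xs↭[])
import Data.List.Relation.Binary.Permutation.Setoid.Properties as PermutationSetoidₚ
open import Data.Product using (_×_; ∃-syntax; _,_; proj₁; proj₂)
open import Data.Sum using (_⊎_; inj₁; inj₂)
open import Data.Empty using (⊥-elim)
open import Level using (Level)
open import Relation.Binary.Core using (Rel)
open import Relation.Binary.PropositionalEquality
  using (_≡_; _≢_; sym; trans; cong; subst; setoid)

Unique-resp-↭ : ∀ {a} {A : Set a} {xs ys : List A} → xs ↭ ys → Unique xs → Unique ys
Unique-resp-↭ {A = A} p = PermutationSetoidₚ.Unique-resp-↭ (setoid A) (↭⇒↭ₛ p)

module Rédei {a ℓ : Level} {A : Set a} (R : Rel A ℓ) where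

  Comparable : Rel A ℓ
  Comparable x y = R x y ⊎ R y x

  -- x is placed just before the first successor y′ with R x y′, or at the
  -- end; the predecessor y, with R y x, keeps the chain linked.
  insertAfter : ∀ {x y ys} → R y x → All (Comparable x) ys → Linked R (y ∷ ys) →
                ∃[ zs ] (Linked R (y ∷ zs) × zs ↭ x ∷ ys)
  insertAfter {ys = []} Ryx _ _ = _ ∷ [] , Ryx ∷ [-] , ↭-refl
  insertAfter {x} {ys = y′ ∷ ys} Ryx (inj₁ Rxy′ ∷ _) Ryys =
    x ∷ y′ ∷ ys , Ryx ∷ Rxy′ ∷ Linked.tail Ryys , ↭-refl
  insertAfter {x} {ys = y′ ∷ ys} Ryx (inj₂ Ry′x ∷ x~ys) Ryys
    with insertAfter Ry′x x~ys (Linked.tail Ryys)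
  ... | zs , Ry′zs , zs↭ =
    y′ ∷ zs , Linked.head Ryys ∷ Ry′zs , ↭-trans (↭-prep y′ zs↭) (↭-swap y′ x ↭-refl)

  insert : ∀ {x ys} → All (Comparable x) ys → Linked R ys →
           ∃[ zs ] (Linked R zs × zs ↭ x ∷ ys)
  insert {ys = []} _ _ = _ ∷ [] , [-] , ↭-refl
  insert {x} {y ∷ ys} (inj₁ Rxy ∷ _) Rys = x ∷ y ∷ ys , Rxy ∷ Rys , ↭-refl
  insert {x} {y ∷ ys} (inj₂ Ryx ∷ x~ys) Rys with insertAfter Ryx x~ys Rys
  ... | zs , Ryzs , zs↭ = y ∷ zs , Ryzs , ↭-trans (↭-prep y zs↭) (↭-swap y x ↭-refl)

  hamiltonianPath : ∀ {xs} → AllPairs Comparable xs → ∃[ ys ] (Linked R ys × ys ↭ xs)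
  hamiltonianPath [] = [] , [] , ↭-refl
  hamiltonianPath {x ∷ xs} (x~xs ∷ xs~) with hamiltonianPath xs~
  ... | ys , Rys , ys↭xs with insert (All-resp-↭ (↭-sym ys↭xs) x~xs) Rys
  ... | zs , Rzs , zs↭ = zs , Rzs , ↭-trans zs↭ (↭-prep x ys↭xs)

module _ {n c : ℕ} (D : SMD n c) where
  open SMD D

  rep : Fin c → Fin n
  rep j = proj₁ (part-surj j)

  part-rep : ∀ j → part (rep j) ≡ j
  part-rep j = proj₂ (part-surj j)

  transversal : List (Fin n)
  transversal = map rep (allFin c)

  length-transversal : length transversal ≡ c
  length-transversal = trans (length-map rep (allFin c)) (length-tabulate (λ j → j))

  rep∈transversal : ∀ j → rep j ∈ transversal
  rep∈transversal j = ∈-map⁺ rep (∈-allFin j)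

  transversal-cross : AllPairs (λ u v → part u ≢ part v) transversal
  transversal-cross = AllPairsₚ.map⁺ (AllPairs.map separate (Uniqueₚ.allFin⁺ c))
    where
    separate : ∀ {i j} → i ≢ j → part (rep i) ≢ part (rep j)
    separate {i} {j} i≢j e = i≢j (trans (sym (part-rep i)) (trans e (part-rep j)))

  transversal-unique : Unique transversal
  transversal-unique = AllPairs.map (λ ≢part u≡v → ≢part (cong part u≡v)) transversal-cross

  transversalPath : c ≥ 1 → ∃[ P ] (IsPath D P × toList P ↭ transversal)
  transversalPath (s≤s _)
    with Rédei.hamiltonianPath Arc (AllPairs.map (semicomplete _ _) transversal-cross)
  ... | [] , _ , []↭ = ⊥-elim (¬x∷xs↭[] (↭-sym []↭))
  ... | u ∷ us , path , P↭ = u ∷ us , path , P↭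

  vertices-singleton : (P : List⁺ (Fin n)) → vertices D (P ∷ []) ≡ toList P
  vertices-singleton P = ++-identityʳ (toList P)

  singleton-IsGPath : ∀ {P} → IsPath D P → Unique (toList P) → IsGPath D (P ∷ [])
  singleton-IsGPath {P} path unique = record
    { paths    = path ∷ []
    ; disjoint = subst Unique (sym (vertices-singleton P)) unique
    ; linked   = [-]
    }

  gLength-singleton : (P : List⁺ (Fin n)) → gLength D (P ∷ []) ≡ length (tail P)
  gLength-singleton P = +-identityʳ (length (tail P))

proposition3p2 : ∀ (n c : ℕ) → c ≥ 1 → (D : SMD n c) →
    ∃[ Ps ] (IsGPath D Ps × IsGood D Ps × gLength D Ps ≡ c ∸ 1)
proposition3p2 n c c≥1 D with transversalPath D c≥1
... | P , path , P↭T = P ∷ [] , singleton-IsGPath D path unique , good , arcs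
  where
  unique : Unique (toList P)
  unique = Unique-resp-↭ (↭-sym P↭T) (transversal-unique D)

  good : IsGood D (P ∷ [])
  good j = rep D j
         , subst (rep D j ∈_) (sym (vertices-singleton D P))
                 (∈-resp-↭ (↭-sym P↭T) (rep∈transversal D j))
         , part-rep D j

  arcs : gLength D (P ∷ []) ≡ c ∸ 1
  arcs = trans (gLength-singleton D P)
               (cong (_∸ 1) (trans (↭-length P↭T) (length-transversal D)))
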